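{- Let $G$ be a graph with $d(G)=c$, let $\gamma>0$, and let $S\subset V(G)$ satisfy $|N(S)|<\gamma|S|$. Then either $d(G-S)\geq c$ or $d(B(S))\geq(1-\gamma)c$.
   Context: $d(\cdot)$ denotes average degree; for a vertex set $T$, $d(T)$ is the average degree of the induced subgraph $G[T]$. $G-S$ is the subgraph induced on $V(G)\setminus S$. $N(S)=\left(\bigcup_{v\in S}N(v)\right)\setminus S$ is the neighbourhood of $S$ and $B(S)=S\cup N(S)$.
   Formalization: The parameter γ ranges over the positive rationals. -}

module Defs where

open import Data.Bool using (Bool; true; false; if_then_else_; _∧_; not; T)
open import Data.Nat as ℕ using (ℕ; zero; suc)
open import Data.Fin using (Fin)
open import Data.Fin.Subset using (Subset; ∣_∣; _∪_)
open import Data.List using (List; map; filter; length)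
open import Data.Nat.ListAction using (sum)
open import Data.Bool.ListAction using (any)
open import Data.List.Base using (allFin)
open import Data.Vec using (lookup; tabulate)
open import Data.Integer using (+_)
open import Data.Rational using (ℚ; _/_; 0ℚ)
open import Relation.Binary.PropositionalEquality using (_≡_)
open import Data.Bool.Properties using (T?)

record Graph (n : ℕ) : Set where
  field
    adj    : Fin n → Fin n → Bool
    sym    : ∀ u v → adj u v ≡ adj v u
    irrefl : ∀ v → adj v v ≡ false
open Graph public

_∈ᵇ_ : {n : ℕ} → Fin n → Subset n → Bool
v ∈ᵇ S = lookup S v

countIn : {n : ℕ} → Subset n → (Fin n → Bool) → ℕ
countIn {n} X P = length (filter (λ u → T? (u ∈ᵇ X ∧ P u)) (allFin n))

degIn : {n : ℕ} → Graph n → Subset n → Fin n → ℕ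
degIn G X v = countIn X (adj G v)

-- sum of degrees in G[T]  (= 2 e(G[T]))
degSum : {n : ℕ} → Graph n → Subset n → ℕ
degSum {n} G T = sum (map (λ v → if v ∈ᵇ T then degIn G T v else 0) (allFin n))

-- average degree d(T) of G[T]; by convention 0 for the empty vertex set
avgDeg : {n : ℕ} → Graph n → Subset n → ℚ
avgDeg G T with ∣ T ∣
... | zero  = 0ℚ
... | suc k = (+ degSum G T) / suc k

nbhd : {n : ℕ} → Graph n → Subset n → Subset n
nbhd {n} G S = tabulate (λ v → not (v ∈ᵇ S) ∧ any (λ u → (u ∈ᵇ S) ∧ adj G u v) (allFin n))

ball : {n : ℕ} → Graph n → Subset n → Subset n
ball G S = S ∪ nbhd G S

-- Every edge of G lies in G − S or in G[B(S)], since an edge meeting S has both ends in B(S).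
-- Counting degrees, c·n ≤ d(G − S)·|V ∖ S| + d(B(S))·|B(S)|, and |B(S)| ≤ |S| + |N(S)| < (1 + γ)|S|.
-- If both conclusions failed, the right-hand side would be smaller than
-- c·|V ∖ S| + (1 − γ)(1 + γ)c·|S| ≤ c·n.
module Submission where

open import Defs
open import Data.Nat using (ℕ)
open import Data.Fin.Subset using (Subset; ⊤; ∁; ∣_∣)
open import Data.Integer using (+_)
open import Data.Rational using (ℚ; _<_; _≤_; _*_; _-_; 0ℚ; 1ℚ; _/_)
open import Data.Sum using (_⊎_)
open import Relation.Binary.PropositionalEquality using (_≡_)

open import Data.Bool using (Bool; true; false; if_then_else_; _∧_; _∨_; not; T)
open import Data.Bool.Properties using (T?; T-∧; T-∨)
open import Data.Bool.ListAction using (any)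
open import Data.Fin using (Fin)
open import Data.Fin.Subset using (_∪_)
open import Data.Fin.Subset.Properties using (∣⊤∣≡n; ∣∁p∣≡n∸∣p∣; ∣p∣≤n)
open import Data.Integer as ℤ using (ℤ)
import Data.Integer.Properties as ℤ
open import Data.Integer.GCD using (gcd)
import Data.Integer.Solver as ℤ-Solver
open import Data.List using ([]; _∷_; map; filter; length; allFin)
open import Data.List.Membership.Propositional.Properties using (∈-allFin)
open import Data.List.Properties using (map-cong)
import Data.List.Relation.Unary.Any as Any
open import Data.List.Relation.Unary.Any.Properties using (any⁺)
import Data.Nat as ℕ
import Data.Nat.Properties as ℕ
open import Data.Nat.ListAction using (sum)
open import Algebra.Properties.CommutativeSemigroup ℕ.+-commutativeSemigroup using (interchange)
open import Data.Product using (_,_; proj₂)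
open import Data.Rational using (_+_; ↥_; ↧_; toℚᵘ; Positive; NonNegative; positive; nonNegative)
open import Data.Rational.Properties
open import Data.Rational.Unnormalised as ℚᵘ using (mkℚᵘ; *≡*; *≤*)
  renaming (_≃_ to _≃ᵘ_; ↥_ to ↥ᵘ_; ↧_ to ↧ᵘ_)
import Data.Rational.Unnormalised.Properties as ℚᵘ
import Data.Rational.Solver as ℚ-Solver
open import Data.Sum using (inj₁; inj₂)
open import Data.Vec using ([]; _∷_)
open import Data.Vec.Properties using (lookup-map; lookup-zipWith; lookup∘tabulate)
open import Function using (_∘_; Equivalence)
open import Relation.Nullary using (¬_; yes; no)
open import Relation.Nullary.Negation using (contradiction)
open import Relation.Binary.PropositionalEquality using (refl; cong; cong₂; subst)
import Relation.Binary.PropositionalEquality as ≡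

fromℕ : ℕ → ℚ
fromℕ k = + k / 1

toℚᵘ-/ : ∀ i d → toℚᵘ (i / ℕ.suc d) ≃ᵘ mkℚᵘ i d
toℚᵘ-/ i d = *≡* (begin
  ↥ᵘ (toℚᵘ q) ℤ.* + ℕ.suc d   ≡⟨ cong (ℤ._* + ℕ.suc d) (↥ᵘ-toℚᵘ q) ⟩
  ↥ q ℤ.* + ℕ.suc d           ≡⟨ cong (↥ q ℤ.*_) (↧-/ i (ℕ.suc d)) ⟨
  ↥ q ℤ.* (↧ q ℤ.* g)         ≡⟨ cong (↥ q ℤ.*_) (ℤ.*-comm (↧ q) g) ⟩
  ↥ q ℤ.* (g ℤ.* ↧ q)         ≡⟨ ℤ.*-assoc (↥ q) g (↧ q) ⟨
  (↥ q ℤ.* g) ℤ.* ↧ q         ≡⟨ cong (ℤ._* ↧ q) (↥-/ i (ℕ.suc d)) ⟩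
  i ℤ.* ↧ q                   ≡⟨ cong (i ℤ.*_) (↧ᵘ-toℚᵘ q) ⟨
  i ℤ.* ↧ᵘ (toℚᵘ q)           ∎)
  where
  open ≡.≡-Reasoning
  q : ℚ
  q = i / ℕ.suc d
  g : ℤ
  g = gcd i (+ ℕ.suc d)

fromℕ-nonNeg : ∀ k → 0ℚ ≤ fromℕ k
fromℕ-nonNeg k = nonNegative⁻¹ (fromℕ k) {{normalize-nonNeg k 1}}

fromℕ-mono-≤ : ∀ {a b} → a ℕ.≤ b → fromℕ a ≤ fromℕ b
fromℕ-mono-≤ {a} {b} a≤b = toℚᵘ-cancel-≤
  (ℚᵘ.≤-respˡ-≃ (ℚᵘ.≃-sym (toℚᵘ-/ (+ a) 0)) (ℚᵘ.≤-respʳ-≃ (ℚᵘ.≃-sym (toℚᵘ-/ (+ b) 0))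
    (*≤* (ℤ.*-monoʳ-≤-nonNeg (+ 1) (ℤ.+≤+ a≤b)))))

fromℕ-+ : ∀ a b → fromℕ (a ℕ.+ b) ≡ fromℕ a + fromℕ b
fromℕ-+ a b = toℚᵘ-injective (begin
  toℚᵘ (fromℕ (a ℕ.+ b))             ≈⟨ toℚᵘ-/ (+ (a ℕ.+ b)) 0 ⟩
  mkℚᵘ (+ (a ℕ.+ b)) 0               ≈⟨ *≡* (+-over-1 (+ a) (+ b)) ⟩
  mkℚᵘ (+ a) 0 ℚᵘ.+ mkℚᵘ (+ b) 0     ≈⟨ ℚᵘ.+-cong (toℚᵘ-/ (+ a) 0) (toℚᵘ-/ (+ b) 0) ⟨
  toℚᵘ (fromℕ a) ℚᵘ.+ toℚᵘ (fromℕ b) ≈⟨ toℚᵘ-homo-+ (fromℕ a) (fromℕ b) ⟨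
  toℚᵘ (fromℕ a + fromℕ b)           ∎)
  where
  open ℚᵘ.≃-Reasoning
  open ℤ-Solver.+-*-Solver
  +-over-1 : ∀ x y → (x ℤ.+ y) ℤ.* + 1 ≡ (x ℤ.* + 1 ℤ.+ y ℤ.* + 1) ℤ.* + 1
  +-over-1 = solve 2 (λ x y → (x :+ y) :* con (+ 1) := (x :* con (+ 1) :+ y :* con (+ 1)) :* con (+ 1)) refl

/-*-cancel : ∀ i k → (i / ℕ.suc k) * fromℕ (ℕ.suc k) ≡ i / 1
/-*-cancel i k = toℚᵘ-injective (begin
  toℚᵘ ((i / ℕ.suc k) * fromℕ (ℕ.suc k))         ≈⟨ toℚᵘ-homo-* (i / ℕ.suc k) (fromℕ (ℕ.suc k)) ⟩
  toℚᵘ (i / ℕ.suc k) ℚᵘ.* toℚᵘ (fromℕ (ℕ.suc k)) ≈⟨ ℚᵘ.*-cong (toℚᵘ-/ i k) (toℚᵘ-/ (+ ℕ.suc k) 0) ⟩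
  mkℚᵘ i k ℚᵘ.* mkℚᵘ (+ ℕ.suc k) 0               ≈⟨ *≡* cancel ⟩
  mkℚᵘ i 0                                       ≈⟨ toℚᵘ-/ i 0 ⟨
  toℚᵘ (i / 1)                                   ∎)
  where
  open ℚᵘ.≃-Reasoning
  cancel : (i ℤ.* + ℕ.suc k) ℤ.* + 1 ≡ i ℤ.* + (ℕ.suc k ℕ.* 1)
  cancel = ≡.trans (ℤ.*-identityʳ _) (cong (λ m → i ℤ.* + m) (≡.sym (ℕ.*-identityʳ (ℕ.suc k))))

average-dichotomy : ∀ {c γ x y a s b m} → 0ℚ ≤ γ → 0ℚ ≤ a → 0ℚ ≤ s → 0ℚ ≤ b → 0ℚ ≤ x → 0ℚ ≤ y →
  c * (a + s) ≤ x * a + y * b → b ≤ s + m → m < γ * s → c ≤ x ⊎ (1ℚ - γ) * c ≤ y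
average-dichotomy {c} {γ} {x} {y} {a} {s} {b} {m} 0≤γ 0≤a 0≤s 0≤b 0≤x 0≤y split b≤s+m m<γs
  with c ≤? x | (1ℚ - γ) * c ≤? y
... | yes c≤x | _       = inj₁ c≤x
... | no _    | yes K≤y = inj₂ K≤y
... | no c≰x  | no K≰y  = contradiction c[a+s]<c[a+s] (<-irrefl refl)
  where
  K : ℚ
  K = (1ℚ - γ) * c
  x<c : x < c
  x<c = ≰⇒> c≰x
  y<K : y < K
  y<K = ≰⇒> K≰y

  instance
    a≥0 : NonNegative a
    a≥0 = nonNegative 0≤a
    b≥0 : NonNegative b
    b≥0 = nonNegative 0≤b
    s≥0 : NonNegative s
    s≥0 = nonNegative 0≤s
    γ≥0 : NonNegative γ
    γ≥0 = nonNegative 0≤γ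
    c>0 : Positive c
    c>0 = positive (≤-<-trans 0≤x x<c)
    c≥0 : NonNegative c
    c≥0 = pos⇒nonNeg c
    K>0 : Positive K
    K>0 = positive (≤-<-trans 0≤y y<K)
    K≥0 : NonNegative K
    K≥0 = pos⇒nonNeg K

  0≤γγcs : 0ℚ ≤ γ * γ * c * s
  0≤γγcs = nonNegative⁻¹ _
    {{nonNeg*nonNeg⇒nonNeg (γ * γ * c) {{nonNeg*nonNeg⇒nonNeg (γ * γ) {{nonNeg*nonNeg⇒nonNeg γ γ}} c}} s}}

  K[s+γs]≤cs : K * (s + γ * s) ≤ c * s
  K[s+γs]≤cs = begin
    K * (s + γ * s)                   ≡⟨ +-identityʳ _ ⟨
    K * (s + γ * s) + 0ℚ              ≤⟨ +-monoʳ-≤ (K * (s + γ * s)) 0≤γγcs ⟩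
    K * (s + γ * s) + γ * γ * c * s   ≡⟨ difference-of-squares γ c s ⟩
    c * s                             ∎
    where
    open ≤-Reasoning
    open ℚ-Solver.+-*-Solver
    difference-of-squares : ∀ γ c s → (1ℚ - γ) * c * (s + γ * s) + γ * γ * c * s ≡ c * s
    difference-of-squares = solve 3
      (λ γ c s → (con 1ℚ :- γ) :* c :* (s :+ γ :* s) :+ γ :* γ :* c :* s := c :* s) refl

  c[a+s]<c[a+s] : c * (a + s) < c * (a + s)
  c[a+s]<c[a+s] = begin-strict
    c * (a + s)             ≤⟨ split ⟩
    x * a + y * b           ≤⟨ +-mono-≤ (*-monoʳ-≤-nonNeg a (<⇒≤ x<c)) (*-monoʳ-≤-nonNeg b (<⇒≤ y<K)) ⟩
    c * a + K * b           ≤⟨ +-monoʳ-≤ (c * a) (*-monoˡ-≤-nonNeg K b≤s+m) ⟩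
    c * a + K * (s + m)     <⟨ +-monoʳ-< (c * a) (*-monoʳ-<-pos K (+-monoʳ-< s m<γs)) ⟩
    c * a + K * (s + γ * s) ≤⟨ +-monoʳ-≤ (c * a) K[s+γs]≤cs ⟩
    c * a + c * s           ≡⟨ *-distribˡ-+ c a s ⟨
    c * (a + s)             ∎
    where open ≤-Reasoning

indicator : Bool → ℕ
indicator true  = 1
indicator false = 0

indicator-⊎ : ∀ {a b c} → (T a → T b ⊎ T c) → indicator a ℕ.≤ indicator b ℕ.+ indicator c
indicator-⊎ {false}                 _ = ℕ.z≤n
indicator-⊎ {true} {true}           _ = ℕ.s≤s ℕ.z≤n
indicator-⊎ {true} {false} {true}   _ = ℕ.≤-refl
indicator-⊎ {true} {false} {false} h with h _
... | inj₁ ()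
... | inj₂ ()

module _ {A : Set} where

  length-filter-T? : ∀ (p : A → Bool) xs → length (filter (T? ∘ p) xs) ≡ sum (map (indicator ∘ p) xs)
  length-filter-T? p []       = refl
  length-filter-T? p (x ∷ xs) with p x
  ... | true  = cong ℕ.suc (length-filter-T? p xs)
  ... | false = length-filter-T? p xs

  sum-map-zero : ∀ {f : A → ℕ} → (∀ x → f x ≡ 0) → ∀ xs → sum (map f xs) ≡ 0
  sum-map-zero f≡0 []       = refl
  sum-map-zero f≡0 (x ∷ xs) = cong₂ ℕ._+_ (f≡0 x) (sum-map-zero f≡0 xs)

  sum-map-≤-+ : ∀ {f g h : A → ℕ} → (∀ x → f x ℕ.≤ g x ℕ.+ h x) → ∀ xs →
    sum (map f xs) ℕ.≤ sum (map g xs) ℕ.+ sum (map h xs)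
  sum-map-≤-+ f≤g+h [] = ℕ.z≤n
  sum-map-≤-+ {g = g} {h} f≤g+h (x ∷ xs) = ℕ.≤-trans (ℕ.+-mono-≤ (f≤g+h x) (sum-map-≤-+ f≤g+h xs))
    (ℕ.≤-reflexive (interchange (g x) (h x) (sum (map g xs)) (sum (map h xs))))

  guarded-length-filter : ∀ b (p : A → Bool) xs →
    (if b then length (filter (T? ∘ p) xs) else 0) ≡ sum (map (λ x → indicator (b ∧ p x)) xs)
  guarded-length-filter true  p xs = length-filter-T? p xs
  guarded-length-filter false p xs = ≡.sym (sum-map-zero (λ _ → refl) xs)

∣p∪q∣≤∣p∣+∣q∣ : ∀ {n} (p q : Subset n) → ∣ p ∪ q ∣ ℕ.≤ ∣ p ∣ ℕ.+ ∣ q ∣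
∣p∪q∣≤∣p∣+∣q∣ []          []          = ℕ.z≤n
∣p∪q∣≤∣p∣+∣q∣ (false ∷ p) (false ∷ q) = ∣p∪q∣≤∣p∣+∣q∣ p q
∣p∪q∣≤∣p∣+∣q∣ (false ∷ p) (true ∷ q)  =
  ℕ.≤-trans (ℕ.s≤s (∣p∪q∣≤∣p∣+∣q∣ p q)) (ℕ.≤-reflexive (≡.sym (ℕ.+-suc ∣ p ∣ ∣ q ∣)))
∣p∪q∣≤∣p∣+∣q∣ (true ∷ p)  (false ∷ q) = ℕ.s≤s (∣p∪q∣≤∣p∣+∣q∣ p q)
∣p∪q∣≤∣p∣+∣q∣ (true ∷ p)  (true ∷ q)  =
  ℕ.s≤s (ℕ.≤-trans (∣p∪q∣≤∣p∣+∣q∣ p q) (ℕ.+-monoʳ-≤ ∣ p ∣ (ℕ.n≤1+n ∣ q ∣)))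

∣p∣≡0⇒∉ : ∀ {n} (p : Subset n) → ∣ p ∣ ≡ 0 → ∀ v → v ∈ᵇ p ≡ false
∣p∣≡0⇒∉ (false ∷ p) ∣p∣≡0 Fin.zero    = refl
∣p∣≡0⇒∉ (false ∷ p) ∣p∣≡0 (Fin.suc v) = ∣p∣≡0⇒∉ p ∣p∣≡0 v

∣∁p∣+∣p∣≡n : ∀ {n} (p : Subset n) → ∣ ∁ p ∣ ℕ.+ ∣ p ∣ ≡ n
∣∁p∣+∣p∣≡n p = ≡.trans (cong (ℕ._+ ∣ p ∣) (∣∁p∣≡n∸∣p∣ p)) (ℕ.m∸n+n≡m (∣p∣≤n p))

edgeIn : ∀ {n} → Graph n → Subset n → Fin n → Fin n → Bool
edgeIn G X v u = v ∈ᵇ X ∧ u ∈ᵇ X ∧ adj G v u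

module _ {n} (G : Graph n) where

  degSum≡Σedges : ∀ X →
    degSum G X ≡ sum (map (λ v → sum (map (indicator ∘ edgeIn G X v) (allFin n))) (allFin n))
  degSum≡Σedges X = cong sum (map-cong
    (λ v → guarded-length-filter (v ∈ᵇ X) (λ u → u ∈ᵇ X ∧ adj G v u) (allFin n)) (allFin n))

  degSum-empty : ∀ X → ∣ X ∣ ≡ 0 → degSum G X ≡ 0
  degSum-empty X ∣X∣≡0 =
    sum-map-zero (λ v → cong (λ b → if b then degIn G X v else 0) (∣p∣≡0⇒∉ X ∣X∣≡0 v)) (allFin n)

  avgDeg*∣X∣≡degSum : ∀ X → avgDeg G X * fromℕ ∣ X ∣ ≡ fromℕ (degSum G X)
  avgDeg*∣X∣≡degSum X with ∣ X ∣ in ∣X∣≡k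
  ... | ℕ.zero  = ≡.trans (*-zeroˡ (fromℕ 0)) (cong fromℕ (≡.sym (degSum-empty X ∣X∣≡k)))
  ... | ℕ.suc k = /-*-cancel (+ degSum G X) k

  avgDeg-nonNeg : ∀ X → 0ℚ ≤ avgDeg G X
  avgDeg-nonNeg X with ∣ X ∣
  ... | ℕ.zero  = ≤-refl
  ... | ℕ.suc k = nonNegative⁻¹ _ {{normalize-nonNeg (degSum G X) (ℕ.suc k)}}

  edgeIn⇒adjacent : ∀ X {v u} → T (edgeIn G X v u) → T (adj G v u)
  edgeIn⇒adjacent X {v} {u} e =
    proj₂ (Equivalence.to (T-∧ {u ∈ᵇ X}) (proj₂ (Equivalence.to (T-∧ {v ∈ᵇ X}) e)))

  edgeIn⁺ : ∀ X {v u} → T (v ∈ᵇ X) → T (u ∈ᵇ X) → T (adj G v u) → T (edgeIn G X v u)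
  edgeIn⁺ X v∈X u∈X vu = Equivalence.from T-∧ (v∈X , Equivalence.from T-∧ (u∈X , vu))

  module _ (S : Subset n) where

    ∈ball⁺ˡ : ∀ {v} → T (v ∈ᵇ S) → T (v ∈ᵇ ball G S)
    ∈ball⁺ˡ {v} v∈S rewrite lookup-zipWith _∨_ v S (nbhd G S) = Equivalence.from T-∨ (inj₁ v∈S)

    ∈ball⁺ʳ : ∀ {u v} → T (u ∈ᵇ S) → T (adj G u v) → T (v ∈ᵇ ball G S)
    ∈ball⁺ʳ {u} {v} u∈S uv
      rewrite lookup-zipWith _∨_ v S (nbhd G S)
            | lookup∘tabulate (λ w → not (w ∈ᵇ S) ∧ any (λ x → x ∈ᵇ S ∧ adj G x w) (allFin n)) v
      with v ∈ᵇ S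
    ... | true  = _
    ... | false = any⁺ _ (Any.map (λ { refl → Equivalence.from T-∧ (u∈S , uv) }) (∈-allFin u))

    ∈∁⁺ : ∀ {v} → ¬ T (v ∈ᵇ S) → T (v ∈ᵇ ∁ S)
    ∈∁⁺ {v} v∉S rewrite lookup-map v not S with v ∈ᵇ S
    ... | true  = v∉S _
    ... | false = _

    adjacent⇒edgeIn-∁-or-ball : ∀ {v u} → T (adj G v u) →
      T (edgeIn G (∁ S) v u) ⊎ T (edgeIn G (ball G S) v u)
    adjacent⇒edgeIn-∁-or-ball {v} {u} vu with T? (v ∈ᵇ S) | T? (u ∈ᵇ S)
    ... | yes v∈S | _       = inj₂ (edgeIn⁺ (ball G S) (∈ball⁺ˡ v∈S) (∈ball⁺ʳ v∈S vu) vu)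
    ... | no _    | yes u∈S = inj₂ (edgeIn⁺ (ball G S) (∈ball⁺ʳ u∈S (subst T (sym G v u) vu)) (∈ball⁺ˡ u∈S) vu)
    ... | no v∉S  | no u∉S  = inj₁ (edgeIn⁺ (∁ S) (∈∁⁺ v∉S) (∈∁⁺ u∉S) vu)

    degSum-⊤≤degSum-∁+degSum-ball : degSum G ⊤ ℕ.≤ degSum G (∁ S) ℕ.+ degSum G (ball G S)
    degSum-⊤≤degSum-∁+degSum-ball
      rewrite degSum≡Σedges ⊤ | degSum≡Σedges (∁ S) | degSum≡Σedges (ball G S) =
      sum-map-≤-+ (λ v → sum-map-≤-+ (λ u →
        indicator-⊎ (adjacent⇒edgeIn-∁-or-ball ∘ edgeIn⇒adjacent ⊤)) (allFin n)) (allFin n)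

    avgDeg-⊤≤avgDeg-∁+avgDeg-ball :
      avgDeg G ⊤ * fromℕ n ≤ (avgDeg G (∁ S) * fromℕ ∣ ∁ S ∣) + (avgDeg G (ball G S) * fromℕ ∣ ball G S ∣)
    avgDeg-⊤≤avgDeg-∁+avgDeg-ball = begin
      avgDeg G ⊤ * fromℕ n                              ≡⟨ cong (λ k → avgDeg G ⊤ * fromℕ k) (∣⊤∣≡n n) ⟨
      avgDeg G ⊤ * fromℕ ∣ ⊤ {n} ∣                      ≡⟨ avgDeg*∣X∣≡degSum ⊤ ⟩
      fromℕ (degSum G ⊤)                                ≤⟨ fromℕ-mono-≤ degSum-⊤≤degSum-∁+degSum-ball ⟩
      fromℕ (degSum G (∁ S) ℕ.+ degSum G (ball G S))    ≡⟨ fromℕ-+ (degSum G (∁ S)) (degSum G (ball G S)) ⟩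
      fromℕ (degSum G (∁ S)) + fromℕ (degSum G (ball G S))
        ≡⟨ cong₂ _+_ (avgDeg*∣X∣≡degSum (∁ S)) (avgDeg*∣X∣≡degSum (ball G S)) ⟨
      (avgDeg G (∁ S) * fromℕ ∣ ∁ S ∣) + (avgDeg G (ball G S) * fromℕ ∣ ball G S ∣) ∎
      where open ≤-Reasoning

proposition2p1 : (n : ℕ) (G : Graph n) (c γ : ℚ) → avgDeg G ⊤ ≡ c → 0ℚ < γ →
    (S : Subset n) → (+ ∣ nbhd G S ∣) / 1 < γ * ((+ ∣ S ∣) / 1) →
    c ≤ avgDeg G (∁ S) ⊎ (1ℚ - γ) * c ≤ avgDeg G (ball G S)
proposition2p1 n G c γ d⊤≡c 0<γ S ∣N∣<γ∣S∣ =
  average-dichotomy (<⇒≤ 0<γ) (fromℕ-nonNeg ∣ ∁ S ∣) (fromℕ-nonNeg ∣ S ∣) (fromℕ-nonNeg ∣ ball G S ∣)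
    (avgDeg-nonNeg G (∁ S)) (avgDeg-nonNeg G (ball G S)) split ∣B∣≤∣S∣+∣N∣ ∣N∣<γ∣S∣
  where
  open ≤-Reasoning
  split : c * ((fromℕ ∣ ∁ S ∣) + (fromℕ ∣ S ∣))
        ≤ (avgDeg G (∁ S) * fromℕ ∣ ∁ S ∣) + (avgDeg G (ball G S) * fromℕ ∣ ball G S ∣)
  split = begin
    c * ((fromℕ ∣ ∁ S ∣) + (fromℕ ∣ S ∣))  ≡⟨ cong (c *_) (fromℕ-+ ∣ ∁ S ∣ ∣ S ∣) ⟨
    c * fromℕ (∣ ∁ S ∣ ℕ.+ ∣ S ∣)      ≡⟨ cong₂ (λ d k → d * fromℕ k) (≡.sym d⊤≡c) (∣∁p∣+∣p∣≡n S) ⟩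
    avgDeg G ⊤ * fromℕ n               ≤⟨ avgDeg-⊤≤avgDeg-∁+avgDeg-ball G S ⟩
    (avgDeg G (∁ S) * fromℕ ∣ ∁ S ∣) + (avgDeg G (ball G S) * fromℕ ∣ ball G S ∣) ∎
  ∣B∣≤∣S∣+∣N∣ : fromℕ ∣ ball G S ∣ ≤ (fromℕ ∣ S ∣) + (fromℕ ∣ nbhd G S ∣)
  ∣B∣≤∣S∣+∣N∣ = begin
    fromℕ ∣ ball G S ∣                    ≤⟨ fromℕ-mono-≤ (∣p∪q∣≤∣p∣+∣q∣ S (nbhd G S)) ⟩
    fromℕ (∣ S ∣ ℕ.+ ∣ nbhd G S ∣)        ≡⟨ fromℕ-+ ∣ S ∣ ∣ nbhd G S ∣ ⟩
    (fromℕ ∣ S ∣) + (fromℕ ∣ nbhd G S ∣)      ∎
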